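{- Consider odd positive integers $m$ such that the quadruple $(m,S(m),S^2(m),S^3(m))$ has distinct coordinates and $m<S^2(m)<S(m)$ (i.e. the triple $(m,S(m),S^2(m))$ has permutation pattern $(1,3,2)$). For such quadruples the only possible permutation patterns are $(1,3,2,4)$, $(2,4,3,1)$, $(1,4,2,3)$, $(1,4,3,2)$, and their permutation densities are \[ d_4(1,3,2,4)=\tfrac1{16},\quad d_4(2,4,3,1)=\tfrac1{16},\quad d_4(1,4,2,3)=0,\quad d_4(1,4,3,2)=0. \] Moreover, the permutation patterns $(1,4,3,2)$ and $(1,4,2,3)$ never occur for any quadruple $(m,S(m),S^2(m),S^3(m))$.
   Context: Let $\Omega$ be the set of odd positive integers. The Syracuse function $S:\Omega\to\Omega$ is defined by $S(m)=(3m+1)/2^e$, where $e$ is the largest integer with $2^e\mid 3m+1$. Let $\Sigma_n$ be the permutations of $\{1,\dots,n\}$. For an $n$-tuple $X=(x_1,\dots,x_n)$ of distinct reals with coordinates in increasing order $y_1<\dots<y_n$, the permutation pattern of $X$ is the unique $\sigma\in\Sigma_n$ with $x_i=y_{\sigma(i)}$, written $(\sigma(1),\dots,\sigma(n))$. For $\sigma\in\Sigma_n$, $\Gamma_\sigma(M)$ is the number of $m\in\Omega$, $m\le M$, such that $(m,S(m),\dots,S^{n-1}(m))$ has distinct coordinates and permutation pattern $\sigma$, and $d_n(\sigma)=\lim_{M\to\infty}\Gamma_\sigma(M)/(M/2)$. -}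

module Defs where

open import Data.Nat using (ℕ; zero; suc; _+_; _*_; _<_; _≤_; _<?_; NonZero)
open import Data.Nat.DivMod using (_/_; _%_)
open import Data.Nat.Properties using (_≟_)
open import Data.Fin using (Fin)
import Data.Fin.Properties as FinP
open import Data.Vec using (Vec; []; _∷_; lookup; tabulate)
open import Data.List using (List; length; filter; upTo; allFin)
open import Data.Product using (_×_; ∃)
open import Data.Integer using (+_)
open import Data.Rational using (ℚ; ∣_∣; _-_; Positive) renaming (_/_ to _÷_; _<_ to _<ℚ_)
open import Relation.Nullary using (¬_; Dec)
open import Relation.Nullary.Decidable using (_→-dec_; ¬?; _×-dec_)
open import Relation.Binary.PropositionalEquality using (_≡_; _≢_)
open import Data.Vec.Properties using () renaming (≡-dec to vec≡-dec)

-- Odd positive integers: m % 2 ≡ 1 (automatically m ≥ 1).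
Odd : ℕ → Set
Odd m = m % 2 ≡ 1

odd? : (m : ℕ) → Dec (Odd m)
odd? m = (m % 2) ≟ 1

-- Remove all factors of 2 from n, using fuel (fuel ≥ n suffices).
stripTwos : ℕ → ℕ → ℕ
stripTwos zero    n = n
stripTwos (suc f) zero = zero
stripTwos (suc f) (suc k) with (suc k) % 2
... | zero  = stripTwos f (suc k / 2)
... | suc _ = suc k

-- Syracuse map: S m = (3m+1)/2^e with e maximal such that 2^e ∣ 3m+1.
S : ℕ → ℕ
S m = stripTwos (3 * m + 1) (3 * m + 1)

S^ : ℕ → ℕ → ℕ
S^ zero    m = m
S^ (suc k) m = S (S^ k m)

orbit : (n : ℕ) → ℕ → Vec ℕ n
orbit n m = tabulate (λ i → S^ (Data.Fin.toℕ i) m)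

Distinct : ∀ {n} → Vec ℕ n → Set
Distinct {n} v = (i j : Fin n) → i ≢ j → lookup v i ≢ lookup v j

distinct? : ∀ {n} (v : Vec ℕ n) → Dec (Distinct v)
distinct? v = FinP.all? λ i → FinP.all? λ j →
  ¬? (i FinP.≟ j) →-dec ¬? (lookup v i ≟ lookup v j)

-- rank of coordinate i: 1 + #{ j : v_j < v_i }.  For a tuple with distinct
-- coordinates, pattern v is exactly the σ with x_i = y_{σ(i)} (y = sorted v).
rank : ∀ {n} → Vec ℕ n → Fin n → ℕ
rank {n} v i = suc (length (filter (λ j → lookup v j <? lookup v i) (allFin n)))

pattern′ : ∀ {n} → Vec ℕ n → Vec ℕ n
pattern′ v = tabulate (rank v)

HasPattern : (n : ℕ) → Vec ℕ n → ℕ → Set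
HasPattern n σ m = Odd m × Distinct (orbit n m) × pattern′ (orbit n m) ≡ σ

hasPattern? : (n : ℕ) (σ : Vec ℕ n) (m : ℕ) → Dec (HasPattern n σ m)
hasPattern? n σ m = odd? m ×-dec (distinct? (orbit n m) ×-dec vec≡-dec _≟_ (pattern′ (orbit n m)) σ)

Γ : (n : ℕ) → Vec ℕ n → ℕ → ℕ
Γ n σ M = length (filter (hasPattern? n σ) (upTo (suc M)))

-- d_n(σ) = q :  Γ_σ(M) / (M/2) → q  as M → ∞
HasDensity : (n : ℕ) → Vec ℕ n → ℚ → Set
HasDensity n σ q = (ε : ℚ) → Positive ε → ∃ λ N → (M : ℕ) → .{{_ : NonZero M}} → N ≤ M →
  ∣ ((+ (2 * Γ n σ M)) ÷ M) - q ∣ <ℚ ε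

module Submission where

-- Computing S on residue classes shows that an odd m with m < S²(m) < S(m) lies in
-- the class 27 or the class 11 mod 32.  On these classes the first steps of the
-- orbit are explicit affine functions of m (for the class 11 the third step is only
-- bounded above), which fixes the pattern of the quadruple as (1,3,2,4), resp.
-- (2,4,3,1).  Hence (1,4,2,3) and (1,4,3,2), whose first three entries also form
-- the pattern (1,3,2), never occur, while each of the two possible patterns is
-- realised by exactly one residue class mod 32, whose share of the odd numbers
-- is 2/32 = 1/16.

open import Defs
open import Data.Nat using (ℕ; zero; suc; _+_; _*_; _∸_; _^_; _≤_; _<_; _<?_; z≤n; s≤s; z<s; NonZero; ∣_-_∣; _⊔_)
open import Data.Nat.Properties
open import Data.Nat.DivMod using (_%_; _/_; m*n%n≡0; m*n/n≡m; m/n≤m; [m+kn]%n≡m%n; m≡m%n+[m/n]*n; m%n<n; m<n⇒m%n≡m; n%n≡0; %-distribˡ-+; m%n%n≡m%n)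
open import Data.Nat.Tactic.RingSolver using (solve)
open import Data.Integer as ℤ using (ℤ; +_; _⊖_)
import Data.Integer.Properties as ℤP
open import Data.Rational as ℚ using (ℚ; mkℚ; 0ℚ; Positive; toℚᵘ) renaming (_/_ to _÷_)
import Data.Rational.Properties as ℚP
import Data.Rational.Unnormalised as ℚᵘ
import Data.Rational.Unnormalised.Properties as ℚᵘP
open import Data.Fin using (#_)
open import Data.Vec using (Vec; []; _∷_; lookup)
open import Data.Vec.Properties using (lookup∘tabulate)
open import Data.List using (_∷_; [_]; _++_; filter; length; upTo; applyUpTo; allFin)
open import Data.List.Properties using (filter-++; length-++; filter-none; filter-accept; filter-notAll; filter-≐; length-tabulate)
open import Data.List.Membership.Propositional using (_∈_)
open import Data.List.Membership.Propositional.Properties using (∈-allFin)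
open import Data.List.Relation.Unary.All using (universal)
open import Data.List.Relation.Unary.All.Properties using (applyUpTo⁺₁)
open import Data.List.Relation.Unary.Any using (here; there)
import Data.List.Relation.Unary.Any as Any
open import Data.List.Relation.Binary.Sublist.Propositional using (⊆-refl)
open import Data.List.Relation.Binary.Sublist.Propositional.Properties using (filter⁺; length-mono-≤)
open import Data.Product using (_×_; _,_; proj₁; proj₂; ∃; ∃-syntax; map₂)
open import Data.Sum as Sum using (_⊎_; inj₁; inj₂; [_,_]′)
open import Data.Empty using (⊥-elim)
open import Function using (_∘_; _⇔_; mk⇔; Equivalence)
open import Relation.Binary.PropositionalEquality hiding ([_])
open import Relation.Nullary using (¬_; yes; no)
open import Relation.Nullary.Decidable using (True; toWitness; from-yes)
open import Relation.Unary using (Decidable)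

-- The Syracuse map

stripTwos-halve : ∀ f n → 0 < n → n % 2 ≡ 0 → stripTwos (suc f) n ≡ stripTwos f (n / 2)
stripTwos-halve f (suc k) _ even with suc k % 2 | even
... | .0 | refl = refl

stripTwos-double : ∀ f n → stripTwos (suc f) (2 * n) ≡ stripTwos f n
stripTwos-double zero    zero    = refl
stripTwos-double (suc f) zero    = refl
stripTwos-double f       (suc n) = begin
  stripTwos (suc f) (2 * suc n)  ≡⟨ stripTwos-halve f (2 * suc n) z<s (trans (cong (_% 2) 2n≡n2) (m*n%n≡0 (suc n) 2)) ⟩
  stripTwos f (2 * suc n / 2)    ≡⟨ cong (stripTwos f) (trans (cong (_/ 2) 2n≡n2) (m*n/n≡m (suc n) 2)) ⟩
  stripTwos f (suc n)            ∎
  where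
  open ≡-Reasoning
  2n≡n2 = *-comm 2 (suc n)

stripTwos-odd : ∀ f n → Odd n → stripTwos (suc f) n ≡ n
stripTwos-odd f (suc k) odd with suc k % 2 | odd
... | .1 | refl = refl

stripTwos-≤ : ∀ f n → stripTwos f n ≤ n
stripTwos-≤ zero    n       = ≤-refl
stripTwos-≤ (suc f) zero    = ≤-refl
stripTwos-≤ (suc f) (suc k) with suc k % 2
... | zero  = ≤-trans (stripTwos-≤ f (suc k / 2)) (m/n≤m (suc k) 2)
... | suc _ = ≤-refl

stripTwos-2^* : ∀ k f n → stripTwos (k + f) (2 ^ k * n) ≡ stripTwos f n
stripTwos-2^* zero    f n = cong (stripTwos f) (*-identityˡ n)
stripTwos-2^* (suc k) f n = begin
  stripTwos (suc (k + f)) (2 * 2 ^ k * n)    ≡⟨ cong (stripTwos (suc (k + f))) (*-assoc 2 (2 ^ k) n) ⟩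
  stripTwos (suc (k + f)) (2 * (2 ^ k * n))  ≡⟨ stripTwos-double (k + f) (2 ^ k * n) ⟩
  stripTwos (k + f) (2 ^ k * n)              ≡⟨ stripTwos-2^* k f n ⟩
  stripTwos f n                              ∎
  where open ≡-Reasoning

n<2^n : ∀ n → n < 2 ^ n
n<2^n zero    = s≤s z≤n
n<2^n (suc n) = begin-strict
  suc n          <⟨ +-monoʳ-≤ 1 (n<2^n n) ⟩
  1 + 2 ^ n      ≤⟨ +-monoˡ-≤ (2 ^ n) (m^n>0 2 n) ⟩
  2 ^ n + 2 ^ n  ≡⟨ cong (λ x → 2 ^ n + x) (sym (+-identityʳ (2 ^ n))) ⟩
  2 * 2 ^ n      ∎
  where open ≤-Reasoning

-- With 3m+1 = 2^k (n+1), the fuel 3m+1 of stripTwos exceeds k, so S m is the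
-- result of stripping the factors 2 from n+1.
S-stripTwos : ∀ m k n → 3 * m + 1 ≡ 2 ^ k * suc n → ∃[ f ] S m ≡ stripTwos (suc f) (suc n)
S-stripTwos m k n eq = N ∸ suc k , (begin
  stripTwos N N                        ≡⟨ cong₂ stripTwos fuel eq ⟩
  stripTwos (k + suc (N ∸ suc k)) (2 ^ k * suc n)  ≡⟨ stripTwos-2^* k _ (suc n) ⟩
  stripTwos (suc (N ∸ suc k)) (suc n)  ∎)
  where
  open ≡-Reasoning
  N = 3 * m + 1
  k<N : k < N
  k<N = ≤-trans (n<2^n k) (≤-trans (m≤m*n (2 ^ k) (suc n)) (≤-reflexive (sym eq)))
  fuel : N ≡ k + suc (N ∸ suc k)
  fuel = sym (trans (+-suc k (N ∸ suc k)) (m+[n∸m]≡n k<N))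

S-odd-part : ∀ m k n → 3 * m + 1 ≡ 2 ^ k * n → Odd n → S m ≡ n
S-odd-part m k (suc n) eq odd with S-stripTwos m k n eq
... | f , S≡ = trans S≡ (stripTwos-odd f (suc n) odd)

S-≤ : ∀ m k n → 3 * m + 1 ≡ 2 ^ k * n → S m ≤ n
S-≤ m k zero    eq with () ← m+n≡0⇒n≡0 (3 * m) (trans eq (*-zeroʳ (2 ^ k)))
S-≤ m k (suc n) eq with S-stripTwos m k n eq
... | f , S≡ = ≤-trans (≤-reflexive S≡) (stripTwos-≤ (suc f) (suc n))

-- Residue classes mod 32

m≡r+n*[m/n] : ∀ {m r} n .{{_ : NonZero n}} → m % n ≡ r → m ≡ r + n * (m / n)
m≡r+n*[m/n] {m} n m%n≡r = trans (m≡m%n+[m/n]*n m n) (cong₂ _+_ m%n≡r (*-comm (m / n) n))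

[m+n*k]%n≡m%n : ∀ m k n .{{_ : NonZero n}} → (m + n * k) % n ≡ m % n
[m+n*k]%n≡m%n m k n = trans (cong (λ x → (m + x) % n) (*-comm n k)) ([m+kn]%n≡m%n m k n)

Odd-≡1+2* : ∀ n k → n ≡ 1 + 2 * k → Odd n
Odd-≡1+2* _ k refl = [m+n*k]%n≡m%n 1 k 2

data EvenOdd : ℕ → Set where
  even : ∀ k → EvenOdd (2 * k)
  odd  : ∀ k → EvenOdd (1 + 2 * k)

evenOdd : ∀ n → EvenOdd n
evenOdd zero    = even 0
evenOdd (suc n) with evenOdd n
... | even k = odd k
... | odd k  = subst EvenOdd (cong suc (+-suc k (k + 0))) (even (suc k))

≤-by-gap : ∀ {m n} k → m + k ≡ n → m ≤ n
≤-by-gap {m} k refl = m≤m+n m k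

m<Sm⇒m≢1+4a : ∀ {m} a → m < S m → m ≢ 1 + 4 * a
m<Sm⇒m≢1+4a a m<Sm refl = <⇒≱ m<Sm (begin
  S (1 + 4 * a)  ≤⟨ S-≤ (1 + 4 * a) 2 (1 + 3 * a) (solve [ a ]) ⟩
  1 + 3 * a      ≤⟨ ≤-by-gap a (solve [ a ]) ⟩
  1 + 4 * a      ∎)
  where open ≤-Reasoning

S²m<Sm⇒m≢7+8b : ∀ {m} b → S (S m) < S m → m ≢ 7 + 8 * b
S²m<Sm⇒m≢7+8b b S²m<Sm refl = <⇒≱ S²m<Sm (begin
  S (7 + 8 * b)      ≡⟨ Sm≡ ⟩
  11 + 12 * b        ≤⟨ ≤-by-gap (6 + 6 * b) (solve [ b ]) ⟩
  17 + 18 * b        ≡⟨ S²m≡ ⟨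
  S (11 + 12 * b)    ≡⟨ cong S Sm≡ ⟨
  S (S (7 + 8 * b))  ∎)
  where
  open ≤-Reasoning
  Sm≡ : S (7 + 8 * b) ≡ 11 + 12 * b
  Sm≡ = S-odd-part (7 + 8 * b) 1 (11 + 12 * b) (solve [ b ]) (Odd-≡1+2* (11 + 12 * b) (5 + 6 * b) (solve [ b ]))
  S²m≡ : S (11 + 12 * b) ≡ 17 + 18 * b
  S²m≡ = S-odd-part (11 + 12 * b) 1 (17 + 18 * b) (solve [ b ]) (Odd-≡1+2* (17 + 18 * b) (8 + 9 * b) (solve [ b ]))

m<S²m⇒m≢3+16c : ∀ {m} c → m < S (S m) → m ≢ 3 + 16 * c
m<S²m⇒m≢3+16c c m<S²m refl = <⇒≱ m<S²m (begin
  S (S (3 + 16 * c))  ≡⟨ cong S Sm≡ ⟩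
  S (5 + 24 * c)      ≤⟨ S-≤ (5 + 24 * c) 3 (2 + 9 * c) (solve [ c ]) ⟩
  2 + 9 * c           ≤⟨ ≤-by-gap (1 + 7 * c) (solve [ c ]) ⟩
  3 + 16 * c          ∎)
  where
  open ≤-Reasoning
  Sm≡ : S (3 + 16 * c) ≡ 5 + 24 * c
  Sm≡ = S-odd-part (3 + 16 * c) 1 (5 + 24 * c) (solve [ c ]) (Odd-≡1+2* (5 + 24 * c) (2 + 12 * c) (solve [ c ]))

classify-132 : ∀ m → Odd m → m < S (S m) → S (S m) < S m →
               (∃[ d ] m ≡ 27 + 32 * d) ⊎ (∃[ d ] m ≡ 11 + 32 * d)
classify-132 m odd-m m<S²m S²m<Sm = go (m / 2) (m≡r+n*[m/n] 2 odd-m)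
  where
  go : ∀ k → m ≡ 1 + 2 * k → (∃[ d ] m ≡ 27 + 32 * d) ⊎ (∃[ d ] m ≡ 11 + 32 * d)
  go k m≡ with evenOdd k
  ... | even a = ⊥-elim (m<Sm⇒m≢1+4a a (<-trans m<S²m S²m<Sm) (trans m≡ (solve [ a ])))
  ... | odd a with evenOdd a
  ...   | odd b = ⊥-elim (S²m<Sm⇒m≢7+8b b S²m<Sm (trans m≡ (solve [ b ])))
  ...   | even b with evenOdd b
  ...     | even c = ⊥-elim (m<S²m⇒m≢3+16c c m<S²m (trans m≡ (solve [ c ])))
  ...     | odd c with evenOdd c
  ...       | odd d  = inj₁ (d , trans m≡ (solve [ d ]))
  ...       | even d = inj₂ (d , trans m≡ (solve [ d ]))

S[27+32d] : ∀ d → S (27 + 32 * d) ≡ 41 + 48 * d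
S[27+32d] d = S-odd-part (27 + 32 * d) 1 (41 + 48 * d) (solve [ d ])
    (Odd-≡1+2* (41 + 48 * d) (20 + 24 * d) (solve [ d ]))

S[41+48d] : ∀ d → S (41 + 48 * d) ≡ 31 + 36 * d
S[41+48d] d = S-odd-part (41 + 48 * d) 2 (31 + 36 * d) (solve [ d ])
    (Odd-≡1+2* (31 + 36 * d) (15 + 18 * d) (solve [ d ]))

S[31+36d] : ∀ d → S (31 + 36 * d) ≡ 47 + 54 * d
S[31+36d] d = S-odd-part (31 + 36 * d) 1 (47 + 54 * d) (solve [ d ])
    (Odd-≡1+2* (47 + 54 * d) (23 + 27 * d) (solve [ d ]))

S[11+32d] : ∀ d → S (11 + 32 * d) ≡ 17 + 48 * d
S[11+32d] d = S-odd-part (11 + 32 * d) 1 (17 + 48 * d) (solve [ d ])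
    (Odd-≡1+2* (17 + 48 * d) (8 + 24 * d) (solve [ d ]))

S[17+48d] : ∀ d → S (17 + 48 * d) ≡ 13 + 36 * d
S[17+48d] d = S-odd-part (17 + 48 * d) 2 (13 + 36 * d) (solve [ d ])
    (Odd-≡1+2* (13 + 36 * d) (6 + 18 * d) (solve [ d ]))

S[13+36d]≤ : ∀ d → S (13 + 36 * d) ≤ 10 + 27 * d
S[13+36d]≤ d = S-≤ (13 + 36 * d) 2 (10 + 27 * d) (solve [ d ])

-- Ranks and permutation patterns

module _ {A : Set} {P Q : A → Set} (P? : Decidable P) (Q? : Decidable Q) (P⇒Q : ∀ {x} → P x → Q x) where

  length-filter-≤ : ∀ xs → length (filter P? xs) ≤ length (filter Q? xs)
  length-filter-≤ xs = length-mono-≤ (filter⁺ P? Q? (λ { refl → P⇒Q }) (⊆-refl {x = xs}))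

  length-filter-< : ∀ {y} xs → y ∈ xs → Q y → ¬ P y → length (filter P? xs) < length (filter Q? xs)
  length-filter-< (x ∷ xs) (here refl) Qy ¬Py with P? x | Q? x
  ... | yes Px | _      = ⊥-elim (¬Py Px)
  ... | no _   | yes _  = s≤s (length-filter-≤ xs)
  ... | no _   | no ¬Qy = ⊥-elim (¬Qy Qy)
  length-filter-< (x ∷ xs) (there y∈xs) Qy ¬Py with P? x | Q? x
  ... | yes Px | yes _  = s≤s (length-filter-< xs y∈xs Qy ¬Py)
  ... | yes Px | no ¬Qx = ⊥-elim (¬Qx (P⇒Q Px))
  ... | no _   | yes _  = m<n⇒m<1+n (length-filter-< xs y∈xs Qy ¬Py)
  ... | no _   | no _   = length-filter-< xs y∈xs Qy ¬Py

module _ {n} (v : Vec ℕ n) where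

  rank-mono-≤ : ∀ {i j} → lookup v i ≤ lookup v j → rank v i ≤ rank v j
  rank-mono-≤ vi≤vj = s≤s (length-filter-≤ _ _ (λ vk<vi → <-≤-trans vk<vi vi≤vj) (allFin n))

  rank-mono-< : ∀ {i j} → lookup v i < lookup v j → rank v i < rank v j
  rank-mono-< {i} vi<vj =
    s≤s (length-filter-< _ _ (λ vk<vi → <-trans vk<vi vi<vj) (allFin n) (∈-allFin i) vi<vj (<-irrefl refl))

  rank-≤ : ∀ i → rank v i ≤ n
  rank-≤ i = ≤-trans (filter-notAll _ (allFin n) (Any.map (λ { refl → <-irrefl refl }) (∈-allFin i)))
                     (≤-reflexive (length-tabulate (λ k → k)))

  lookup-pattern′ : ∀ i → lookup (pattern′ v) i ≡ rank v i
  lookup-pattern′ = lookup∘tabulate (rank v)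

  pattern′-reflects-< : ∀ {σ} → pattern′ v ≡ σ → ∀ {i j} → lookup σ i < lookup σ j → lookup v i < lookup v j
  pattern′-reflects-< refl {i} {j} σi<σj = ≰⇒> λ vj≤vi →
    <⇒≱ σi<σj (subst₂ _≤_ (sym (lookup-pattern′ j)) (sym (lookup-pattern′ i)) (rank-mono-≤ vj≤vi))

  -- The rank of a coordinate depends only on its value.
  pattern′-reflects-Distinct : ∀ {σ} → pattern′ v ≡ σ → Distinct σ → Distinct v
  pattern′-reflects-Distinct refl distinct i j i≢j vi≡vj = distinct i j i≢j (begin
    lookup (pattern′ v) i  ≡⟨ lookup-pattern′ i ⟩
    rank v i               ≡⟨ cong (λ x → suc (length (filter (λ k → lookup v k <? x) (allFin n)))) vi≡vj ⟩
    rank v j               ≡⟨ lookup-pattern′ j ⟨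
    lookup (pattern′ v) j  ∎)
    where open ≡-Reasoning

squeeze-1234 : ∀ {a b c d} → 0 < a → a < b → b < c → c < d → d ≤ 4 → a ≡ 1 × b ≡ 2 × c ≡ 3 × d ≡ 4
squeeze-1234 0<a a<b b<c c<d d≤4 =
  ≤-antisym (≤-pred (≤-trans a<b b≤2)) 0<a , ≤-antisym b≤2 2≤b , ≤-antisym c≤3 3≤c , ≤-antisym d≤4 4≤d
  where
  2≤b = ≤-trans (s≤s 0<a) a<b
  3≤c = ≤-trans (s≤s 2≤b) b<c
  4≤d = ≤-trans (s≤s 3≤c) c<d
  c≤3 = ≤-pred (≤-trans c<d d≤4)
  b≤2 = ≤-pred (≤-trans b<c c≤3)

rank-chain : ∀ (v : Vec ℕ 4) {i j k l} → lookup v i < lookup v j → lookup v j < lookup v k → lookup v k < lookup v l →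
             rank v i ≡ 1 × rank v j ≡ 2 × rank v k ≡ 3 × rank v l ≡ 4
rank-chain v {l = l} vi<vj vj<vk vk<vl =
  squeeze-1234 z<s (rank-mono-< v vi<vj) (rank-mono-< v vj<vk) (rank-mono-< v vk<vl) (rank-≤ v l)

pattern′-from-ranks : ∀ (v : Vec ℕ 4) {σ₀ σ₁ σ₂ σ₃} →
  rank v (# 0) ≡ σ₀ → rank v (# 1) ≡ σ₁ → rank v (# 2) ≡ σ₂ → rank v (# 3) ≡ σ₃ →
  pattern′ v ≡ σ₀ ∷ σ₁ ∷ σ₂ ∷ σ₃ ∷ []
pattern′-from-ranks v refl refl refl refl = refl

pattern′-1324 : ∀ {a b c d} → a < c → c < b → b < d →
                pattern′ (a ∷ b ∷ c ∷ d ∷ []) ≡ 1 ∷ 3 ∷ 2 ∷ 4 ∷ []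
pattern′-1324 {a} {b} {c} {d} a<c c<b b<d with rank-chain (a ∷ b ∷ c ∷ d ∷ []) {# 0} {# 2} {# 1} {# 3} a<c c<b b<d
... | r₀ , r₂ , r₁ , r₃ = pattern′-from-ranks (a ∷ b ∷ c ∷ d ∷ []) r₀ r₁ r₂ r₃

pattern′-2431 : ∀ {a b c d} → d < a → a < c → c < b →
                pattern′ (a ∷ b ∷ c ∷ d ∷ []) ≡ 2 ∷ 4 ∷ 3 ∷ 1 ∷ []
pattern′-2431 {a} {b} {c} {d} d<a a<c c<b with rank-chain (a ∷ b ∷ c ∷ d ∷ []) {# 3} {# 0} {# 2} {# 1} d<a a<c c<b
... | r₃ , r₀ , r₂ , r₁ = pattern′-from-ranks (a ∷ b ∷ c ∷ d ∷ []) r₀ r₁ r₂ r₃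

-- Orbits starting with the pattern (1,3,2)

pattern′-27+32d : ∀ d → pattern′ (orbit 4 (27 + 32 * d)) ≡ 1 ∷ 3 ∷ 2 ∷ 4 ∷ []
pattern′-27+32d d = pattern′-1324 m<S²m S²m<Sm Sm<S³m
  where
  open ≤-Reasoning
  m = 27 + 32 * d
  Sm≡ : S m ≡ 41 + 48 * d
  Sm≡ = S[27+32d] d
  S²m≡ : S (S m) ≡ 31 + 36 * d
  S²m≡ = trans (cong S Sm≡) (S[41+48d] d)
  m<S²m : m < S (S m)
  m<S²m = begin-strict
    27 + 32 * d  <⟨ ≤-by-gap (3 + 4 * d) (solve [ d ]) ⟩
    31 + 36 * d  ≡⟨ S²m≡ ⟨
    S (S m)      ∎
  S²m<Sm : S (S m) < S m
  S²m<Sm = begin-strict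
    S (S m)      ≡⟨ S²m≡ ⟩
    31 + 36 * d  <⟨ ≤-by-gap (9 + 12 * d) (solve [ d ]) ⟩
    41 + 48 * d  ≡⟨ Sm≡ ⟨
    S m          ∎
  Sm<S³m : S m < S (S (S m))
  Sm<S³m = begin-strict
    S m          ≡⟨ Sm≡ ⟩
    41 + 48 * d  <⟨ ≤-by-gap (5 + 6 * d) (solve [ d ]) ⟩
    47 + 54 * d  ≡⟨ trans (cong S S²m≡) (S[31+36d] d) ⟨
    S (S (S m))  ∎

pattern′-11+32d : ∀ d → pattern′ (orbit 4 (11 + 32 * d)) ≡ 2 ∷ 4 ∷ 3 ∷ 1 ∷ []
pattern′-11+32d d = pattern′-2431 S³m<m m<S²m S²m<Sm
  where
  open ≤-Reasoning
  m = 11 + 32 * d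
  Sm≡ : S m ≡ 17 + 48 * d
  Sm≡ = S[11+32d] d
  S²m≡ : S (S m) ≡ 13 + 36 * d
  S²m≡ = trans (cong S Sm≡) (S[17+48d] d)
  S³m<m : S (S (S m)) < m
  S³m<m = begin-strict
    S (S (S m))     ≡⟨ cong S S²m≡ ⟩
    S (13 + 36 * d) ≤⟨ S[13+36d]≤ d ⟩
    10 + 27 * d     <⟨ ≤-by-gap (5 * d) (solve [ d ]) ⟩
    11 + 32 * d     ∎
  m<S²m : m < S (S m)
  m<S²m = begin-strict
    11 + 32 * d  <⟨ ≤-by-gap (1 + 4 * d) (solve [ d ]) ⟩
    13 + 36 * d  ≡⟨ S²m≡ ⟨
    S (S m)      ∎
  S²m<Sm : S (S m) < S m
  S²m<Sm = begin-strict
    S (S m)      ≡⟨ S²m≡ ⟩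
    13 + 36 * d  <⟨ ≤-by-gap (3 + 12 * d) (solve [ d ]) ⟩
    17 + 48 * d  ≡⟨ Sm≡ ⟨
    S m          ∎

pattern′-of-132 : ∀ m → Odd m → m < S (S m) → S (S m) < S m →
    (m % 32 ≡ 27 × pattern′ (orbit 4 m) ≡ 1 ∷ 3 ∷ 2 ∷ 4 ∷ [])
  ⊎ (m % 32 ≡ 11 × pattern′ (orbit 4 m) ≡ 2 ∷ 4 ∷ 3 ∷ 1 ∷ [])
pattern′-of-132 m odd-m m<S²m S²m<Sm =
  Sum.map (λ (d , m≡) → subst (ResidueAndPattern 27 (1 ∷ 3 ∷ 2 ∷ 4 ∷ [])) (sym m≡)
                              ([m+n*k]%n≡m%n 27 d 32 , pattern′-27+32d d))
          (λ (d , m≡) → subst (ResidueAndPattern 11 (2 ∷ 4 ∷ 3 ∷ 1 ∷ [])) (sym m≡)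
                              ([m+n*k]%n≡m%n 11 d 32 , pattern′-11+32d d))
          (classify-132 m odd-m m<S²m S²m<Sm)
  where
  ResidueAndPattern : ℕ → Vec ℕ 4 → ℕ → Set
  ResidueAndPattern r σ x = x % 32 ≡ r × pattern′ (orbit 4 x) ≡ σ

pattern′-132-prefix : ∀ {σ} m → Odd m → pattern′ (orbit 4 m) ≡ σ →
  {_ : True (lookup σ (# 0) <? lookup σ (# 2))} {_ : True (lookup σ (# 2) <? lookup σ (# 1))} →
    (m % 32 ≡ 27 × σ ≡ 1 ∷ 3 ∷ 2 ∷ 4 ∷ []) ⊎ (m % 32 ≡ 11 × σ ≡ 2 ∷ 4 ∷ 3 ∷ 1 ∷ [])
pattern′-132-prefix m odd-m pat {σ₀<σ₂} {σ₂<σ₁} =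
  Sum.map (map₂ (trans (sym pat))) (map₂ (trans (sym pat)))
    (pattern′-of-132 m odd-m (pattern′-reflects-< (orbit 4 m) pat (toWitness σ₀<σ₂))
                             (pattern′-reflects-< (orbit 4 m) pat (toWitness σ₂<σ₁)))

pattern′≢1432 : ∀ m → Odd m → pattern′ (orbit 4 m) ≢ 1 ∷ 4 ∷ 3 ∷ 2 ∷ []
pattern′≢1432 m odd-m pat = [ (λ ()) ∘ proj₂ , (λ ()) ∘ proj₂ ]′ (pattern′-132-prefix m odd-m pat)

pattern′≢1423 : ∀ m → Odd m → pattern′ (orbit 4 m) ≢ 1 ∷ 4 ∷ 2 ∷ 3 ∷ []
pattern′≢1423 m odd-m pat = [ (λ ()) ∘ proj₂ , (λ ()) ∘ proj₂ ]′ (pattern′-132-prefix m odd-m pat)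

HasPattern-27+32d : ∀ d → HasPattern 4 (1 ∷ 3 ∷ 2 ∷ 4 ∷ []) (27 + 32 * d)
HasPattern-27+32d d =
  Odd-≡1+2* (27 + 32 * d) (13 + 16 * d) (solve [ d ]) ,
  pattern′-reflects-Distinct (orbit 4 (27 + 32 * d)) (pattern′-27+32d d) (from-yes (distinct? (1 ∷ 3 ∷ 2 ∷ 4 ∷ []))) ,
  pattern′-27+32d d

HasPattern-11+32d : ∀ d → HasPattern 4 (2 ∷ 4 ∷ 3 ∷ 1 ∷ []) (11 + 32 * d)
HasPattern-11+32d d =
  Odd-≡1+2* (11 + 32 * d) (5 + 16 * d) (solve [ d ]) ,
  pattern′-reflects-Distinct (orbit 4 (11 + 32 * d)) (pattern′-11+32d d) (from-yes (distinct? (2 ∷ 4 ∷ 3 ∷ 1 ∷ []))) ,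
  pattern′-11+32d d

HasPattern-1324⇔residue-27 : ∀ m → HasPattern 4 (1 ∷ 3 ∷ 2 ∷ 4 ∷ []) m ⇔ (m % 32 ≡ 27)
HasPattern-1324⇔residue-27 m = mk⇔
  (λ (odd-m , _ , pat) → [ proj₁ , (λ ()) ∘ proj₂ ]′ (pattern′-132-prefix m odd-m pat))
  (λ m%32≡27 → subst (HasPattern 4 _) (sym (m≡r+n*[m/n] 32 m%32≡27)) (HasPattern-27+32d (m / 32)))

HasPattern-2431⇔residue-11 : ∀ m → HasPattern 4 (2 ∷ 4 ∷ 3 ∷ 1 ∷ []) m ⇔ (m % 32 ≡ 11)
HasPattern-2431⇔residue-11 m = mk⇔
  (λ (odd-m , _ , pat) → [ (λ ()) ∘ proj₂ , proj₁ ]′ (pattern′-132-prefix m odd-m pat))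
  (λ m%32≡11 → subst (HasPattern 4 _) (sym (m≡r+n*[m/n] 32 m%32≡11)) (HasPattern-11+32d (m / 32)))

-- Counting a residue class

applyUpTo-+ : ∀ {A : Set} (f : ℕ → A) m n → applyUpTo f (m + n) ≡ applyUpTo f m ++ applyUpTo (λ i → f (m + i)) n
applyUpTo-+ f zero    n = refl
applyUpTo-+ f (suc m) n = cong (f 0 ∷_) (applyUpTo-+ (f ∘ suc) m n)

module _ {P : ℕ → Set} (P? : Decidable P) where

  length-filter-applyUpTo-cong : ∀ f g → (∀ i → P (f i) ⇔ P (g i)) → ∀ n →
    length (filter P? (applyUpTo f n)) ≡ length (filter P? (applyUpTo g n))
  length-filter-applyUpTo-cong f g f⇔g zero    = refl
  length-filter-applyUpTo-cong f g f⇔g (suc n) with P? (f 0) | P? (g 0)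
  ... | yes _   | yes _   = cong suc (length-filter-applyUpTo-cong (f ∘ suc) (g ∘ suc) (f⇔g ∘ suc) n)
  ... | no _    | no _    = length-filter-applyUpTo-cong (f ∘ suc) (g ∘ suc) (f⇔g ∘ suc) n
  ... | yes Pf0 | no ¬Pg0 = ⊥-elim (¬Pg0 (Equivalence.to (f⇔g 0) Pf0))
  ... | no ¬Pf0 | yes Pg0 = ⊥-elim (¬Pf0 (Equivalence.from (f⇔g 0) Pg0))

module Residue (p : ℕ) .{{_ : NonZero p}} (r : ℕ) where

  residue? : Decidable (λ m → m % p ≡ r)
  residue? m = m % p ≟ r

  countFrom : ℕ → ℕ → ℕ
  countFrom m n = length (filter residue? (applyUpTo (λ i → m + i) n))

  countBelow : ℕ → ℕ
  countBelow = countFrom 0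

  countBelow-split : ∀ m n → countBelow (m + n) ≡ countBelow m + countFrom m n
  countBelow-split m n = begin
    countBelow (m + n)
      ≡⟨ cong (length ∘ filter residue?) (applyUpTo-+ (λ i → i) m n) ⟩
    length (filter residue? (upTo m ++ applyUpTo (λ i → m + i) n))
      ≡⟨ cong length (filter-++ residue? (upTo m) _) ⟩
    length (filter residue? (upTo m) ++ filter residue? (applyUpTo (λ i → m + i) n))
      ≡⟨ length-++ (filter residue? (upTo m)) ⟩
    countBelow m + countFrom m n
      ∎
    where open ≡-Reasoning

  countBelow-+ : ∀ m n → m % p ≡ 0 → countBelow (m + n) ≡ countBelow m + countBelow n
  countBelow-+ m n m%p≡0 = trans (countBelow-split m n)
    (cong (λ c → countBelow m + c) (length-filter-applyUpTo-cong residue? (λ i → m + i) (λ i → i) shift n))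
    where
    shift : ∀ i → ((m + i) % p ≡ r) ⇔ (i % p ≡ r)
    shift i = mk⇔ (trans (sym m+i≡i)) (trans m+i≡i)
      where
      m+i≡i : (m + i) % p ≡ i % p
      m+i≡i = trans (%-distribˡ-+ m i p) (trans (cong (λ x → (x + i % p) % p) m%p≡0) (m%n%n≡m%n i p))

  module _ (r<p : r < p) where

    countBelow-period : countBelow p ≡ 1
    countBelow-period = begin
      countBelow p            ≡⟨ cong countBelow p≡r+1+t ⟩
      countBelow (r + suc t)  ≡⟨ countBelow-split r (suc t) ⟩
      countBelow r + countFrom r (suc t)  ≡⟨ cong₂ _+_ none-below-r one-in-window ⟩
      1                       ∎
      where
      open ≡-Reasoning
      t = p ∸ suc r
      p≡r+1+t : p ≡ r + suc t
      p≡r+1+t = sym (trans (+-suc r t) (m+[n∸m]≡n r<p))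
      none-below-r : countBelow r ≡ 0
      none-below-r = cong length (filter-none residue? (applyUpTo⁺₁ (λ i → i) r λ i<r i%p≡r →
        <⇒≢ i<r (trans (sym (m<n⇒m%n≡m (<-trans i<r r<p))) i%p≡r)))
      one-in-window : countFrom r (suc t) ≡ 1
      one-in-window = begin
        length (filter residue? ((r + 0) ∷ applyUpTo (λ i → r + suc i) t))
          ≡⟨ cong length (filter-accept residue? (trans (cong (_% p) (+-identityʳ r)) (m<n⇒m%n≡m r<p))) ⟩
        suc (length (filter residue? (applyUpTo (λ i → r + suc i) t)))
          ≡⟨ cong (suc ∘ length) (filter-none residue? (applyUpTo⁺₁ (λ i → r + suc i) t λ i<t r+1+i%p≡r →
               m+1+n≢m r (trans (sym (m<n⇒m%n≡m (r+1+i<p i<t))) r+1+i%p≡r))) ⟩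
        1 ∎
        where
        r+1+i<p : ∀ {i} → i < t → r + suc i < p
        r+1+i<p i<t = <-≤-trans (+-monoʳ-< r (s≤s i<t)) (≤-reflexive (sym p≡r+1+t))

    countBelow-multiple : ∀ k → countBelow (k * p) ≡ k
    countBelow-multiple zero    = refl
    countBelow-multiple (suc k) = begin
      countBelow (p + k * p)             ≡⟨ countBelow-+ p (k * p) (n%n≡0 p) ⟩
      countBelow p + countBelow (k * p)  ≡⟨ cong₂ _+_ countBelow-period (countBelow-multiple k) ⟩
      suc k                              ∎
      where open ≡-Reasoning

    countBelow-≤1 : ∀ {n} → n ≤ p → countBelow n ≤ 1
    countBelow-≤1 {n} n≤p = begin
      countBelow n                   ≤⟨ m≤m+n (countBelow n) _ ⟩
      countBelow n + countFrom n (p ∸ n)  ≡⟨ countBelow-split n (p ∸ n) ⟨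
      countBelow (n + (p ∸ n))       ≡⟨ cong countBelow (m+[n∸m]≡n n≤p) ⟩
      countBelow p                   ≡⟨ countBelow-period ⟩
      1                              ∎
      where open ≤-Reasoning

    countBelow-discrepancy : ∀ n → ∣ p * countBelow n - n ∣ ≤ p
    countBelow-discrepancy n = begin
      ∣ p * countBelow n - n ∣                      ≡⟨ cong (λ x → ∣ p * countBelow x - x ∣) n≡kp+s ⟩
      ∣ p * countBelow (k * p + s) - (k * p + s) ∣  ≡⟨ cong (λ c → ∣ p * c - (k * p + s) ∣) count≡ ⟩
      ∣ p * (k + countBelow s) - (k * p + s) ∣      ≡⟨ cong (λ x → ∣ x - (k * p + s) ∣) distrib ⟩
      ∣ k * p + p * countBelow s - (k * p + s) ∣    ≡⟨ ∣m+n-m+o∣≡∣n-o∣ (k * p) _ s ⟩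
      ∣ p * countBelow s - s ∣                      ≤⟨ ∣m-n∣≤m⊔n _ s ⟩
      p * countBelow s ⊔ s                          ≤⟨ ⊔-lub pc≤p (<⇒≤ s<p) ⟩
      p                                             ∎
      where
      open ≤-Reasoning
      k = n / p
      s = n % p
      s<p : s < p
      s<p = m%n<n n p
      n≡kp+s : n ≡ k * p + s
      n≡kp+s = trans (m≡m%n+[m/n]*n n p) (+-comm s (k * p))
      count≡ : countBelow (k * p + s) ≡ k + countBelow s
      count≡ = trans (countBelow-+ (k * p) s (m*n%n≡0 k p)) (cong (_+ countBelow s) (countBelow-multiple k))
      distrib : p * (k + countBelow s) ≡ k * p + p * countBelow s
      distrib = trans (*-distribˡ-+ p k _) (cong (_+ p * countBelow s) (*-comm p k))
      pc≤p : p * countBelow s ≤ p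
      pc≤p = ≤-trans (*-monoʳ-≤ p (countBelow-≤1 (<⇒≤ s<p))) (≤-reflexive (*-identityʳ p))

-- Densities

DensityLimit : (ℕ → ℕ) → ℚ → Set
DensityLimit g q = (ε : ℚ) → Positive ε → ∃ λ N → (M : ℕ) → .{{_ : NonZero M}} → N ≤ M →
  ℚ.∣ (+ (2 * g M)) ÷ M ℚ.- q ∣ ℚ.< ε

∣⊖∣≡∣-∣ : ∀ m n → ℤ.∣ m ⊖ n ∣ ≡ ∣ m - n ∣
∣⊖∣≡∣-∣ m n with ≤-total m n
... | inj₁ m≤n = trans (ℤP.∣⊖∣-≤ m≤n) (sym (m≤n⇒∣m-n∣≡n∸m m≤n))
... | inj₂ n≤m = trans (ℤP.∣m⊖n∣≡∣n⊖m∣ m n) (trans (ℤP.∣⊖∣-≤ n≤m) (sym (m≤n⇒∣n-m∣≡n∸m n≤m)))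

-- Writing ε = (e+1)/d, the distance |2g(M)/M - 2/p| = 2|p g(M) - M|/(pM) ≤ 2K/(pM)
-- is below ε as soon as M > 2Kd.
density-of-bounded-discrepancy : ∀ p K (g : ℕ → ℕ) .{{_ : NonZero p}} →
  (∀ M → ∣ p * g M - M ∣ ≤ K) → DensityLimit g ((+ 2) ÷ p)
density-of-bounded-discrepancy p@(suc p-1) K g bound ε@(mkℚ (+ suc e) d-1 _) _ = suc (2 * K * d) , close
  where
  d = suc d-1
  close : (M : ℕ) → .{{_ : NonZero M}} → suc (2 * K * d) ≤ M → ℚ.∣ (+ (2 * g M)) ÷ M ℚ.- (+ 2) ÷ p ∣ ℚ.< ε
  close M@(suc M-1) N≤M = ℚP.toℚᵘ-cancel-< (ℚᵘP.<-respˡ-≃ (ℚᵘP.≃-sym toℚᵘ-distance) (ℚᵘ.*<* num*d<e*den))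
    where
    x y : ℚ
    x = (+ (2 * g M)) ÷ M
    y = (+ 2) ÷ p
    distance : ℚᵘ.ℚᵘ
    distance = ℚᵘ.∣ ℚᵘ.mkℚᵘ (+ (2 * g M)) M-1 ℚᵘ.+ ℚᵘ.- ℚᵘ.mkℚᵘ (+ 2) p-1 ∣
    toℚᵘ-distance : toℚᵘ (ℚ.∣ x ℚ.- y ∣) ℚᵘ.≃ distance
    toℚᵘ-distance = ℚᵘP.≃-trans (ℚP.toℚᵘ-homo-∣-∣ (x ℚ.+ ℚ.- y))
      (ℚᵘP.∣-∣-cong (ℚᵘP.≃-trans (ℚP.toℚᵘ-homo-+ x (ℚ.- y))
        (ℚᵘP.+-cong (ℚP.toℚᵘ-fromℚᵘ (ℚᵘ.mkℚᵘ (+ (2 * g M)) M-1))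
          (ℚᵘP.≃-trans (ℚP.toℚᵘ-homo‿- y) (ℚᵘP.-‿cong (ℚP.toℚᵘ-fromℚᵘ (ℚᵘ.mkℚᵘ (+ 2) p-1)))))))
    num : ℤ
    num = + (2 * g M) ℤ.* + p ℤ.+ ℤ.- (+ 2) ℤ.* + M
    ∣num∣≡ : ℤ.∣ num ∣ ≡ 2 * ∣ p * g M - M ∣
    ∣num∣≡ = begin
      ℤ.∣ num ∣                          ≡⟨ cong ℤ.∣_∣ (cong₂ ℤ._+_ (sym (ℤP.pos-* (2 * g M) p))
                                              (trans (sym (ℤP.neg-distribˡ-* (+ 2) (+ M))) (cong ℤ.-_ (sym (ℤP.pos-* 2 M))))) ⟩
      ℤ.∣ + (2 * g M * p) ℤ.+ ℤ.- + (2 * M) ∣  ≡⟨ cong ℤ.∣_∣ (ℤP.m-n≡m⊖n (2 * g M * p) (2 * M)) ⟩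
      ℤ.∣ 2 * g M * p ⊖ 2 * M ∣          ≡⟨ ∣⊖∣≡∣-∣ (2 * g M * p) (2 * M) ⟩
      ∣ 2 * g M * p - 2 * M ∣            ≡⟨ cong (λ z → ∣ z - 2 * M ∣) (*-assoc 2 (g M) p) ⟩
      ∣ 2 * (g M * p) - 2 * M ∣          ≡⟨ cong (λ z → ∣ 2 * z - 2 * M ∣) (*-comm (g M) p) ⟩
      ∣ 2 * (p * g M) - 2 * M ∣          ≡⟨ *-distribˡ-∣-∣ 2 (p * g M) M ⟨
      2 * ∣ p * g M - M ∣                ∎
      where open ≡-Reasoning
    num*d<e*den : + ℤ.∣ num ∣ ℤ.* + d ℤ.< + suc e ℤ.* + (M * p)
    num*d<e*den = subst₂ ℤ._<_ (ℤP.pos-* ℤ.∣ num ∣ d) (ℤP.pos-* (suc e) (M * p)) (ℤ.+<+ (begin-strict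
      ℤ.∣ num ∣ * d            ≡⟨ cong (_* d) ∣num∣≡ ⟩
      2 * ∣ p * g M - M ∣ * d  ≤⟨ *-monoˡ-≤ d (*-monoʳ-≤ 2 (bound M)) ⟩
      2 * K * d                <⟨ N≤M ⟩
      M                        ≤⟨ m≤m*n M p ⟩
      M * p                    ≤⟨ m≤n*m (M * p) (suc e) ⟩
      suc e * (M * p)          ∎))
      where open ≤-Reasoning

density-of-zero : ∀ (g : ℕ → ℕ) → (∀ M → g M ≡ 0) → DensityLimit g 0ℚ
density-of-zero g g≡0 ε ε>0 = 0 , λ M _ → subst (λ z → ℚ.∣ z ℚ.- 0ℚ ∣ ℚ.< ε)
  (sym (trans (cong (λ z → (+ (2 * z)) ÷ M) (g≡0 M)) (ℚP.0/n≡0 M))) (ℚP.positive⁻¹ ε {{ε>0}})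

∣1+n-n∣≡1 : ∀ n → ∣ suc n - n ∣ ≡ 1
∣1+n-n∣≡1 zero    = refl
∣1+n-n∣≡1 (suc n) = ∣1+n-n∣≡1 n

HasDensity-of-residue-class : ∀ n σ p r .{{_ : NonZero p}} {r<p : True (r <? p)} →
  (∀ m → HasPattern n σ m ⇔ (m % p ≡ r)) → HasDensity n σ ((+ 2) ÷ p)
HasDensity-of-residue-class n σ p r {r<p} pattern⇔residue =
  density-of-bounded-discrepancy p (p + 1) (Γ n σ) λ M → begin
    ∣ p * Γ n σ M - M ∣                           ≤⟨ ∣-∣-triangle (p * Γ n σ M) (suc M) M ⟩
    ∣ p * Γ n σ M - suc M ∣ + ∣ suc M - M ∣       ≡⟨ cong₂ (λ c e → ∣ p * c - suc M ∣ + e) (Γ≡countBelow M) (∣1+n-n∣≡1 M) ⟩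
    ∣ p * countBelow (suc M) - suc M ∣ + 1         ≤⟨ +-monoˡ-≤ 1 (countBelow-discrepancy (toWitness r<p) (suc M)) ⟩
    p + 1                                          ∎
  where
  open ≤-Reasoning
  open Residue p r
  Γ≡countBelow : ∀ M → Γ n σ M ≡ countBelow (suc M)
  Γ≡countBelow M = cong length (filter-≐ (hasPattern? n σ) residue?
    ((λ {m} → Equivalence.to (pattern⇔residue m)) , (λ {m} → Equivalence.from (pattern⇔residue m))) (upTo (suc M)))

HasDensity-of-absent : ∀ n σ → (∀ m → ¬ HasPattern n σ m) → HasDensity n σ 0ℚ
HasDensity-of-absent n σ absent = density-of-zero (Γ n σ)
  (λ M → cong length (filter-none (hasPattern? n σ) (universal absent (upTo (suc M)))))

mainTheorem12 :
  ((m : ℕ) → Odd m → Distinct (orbit 4 m) → m < S^ 2 m → S^ 2 m < S^ 1 m →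
      (pattern′ (orbit 4 m) ≡ (1 ∷ 3 ∷ 2 ∷ 4 ∷ []))
    ⊎ (pattern′ (orbit 4 m) ≡ (2 ∷ 4 ∷ 3 ∷ 1 ∷ []))
    ⊎ (pattern′ (orbit 4 m) ≡ (1 ∷ 4 ∷ 2 ∷ 3 ∷ []))
    ⊎ (pattern′ (orbit 4 m) ≡ (1 ∷ 4 ∷ 3 ∷ 2 ∷ [])))
  × HasDensity 4 (1 ∷ 3 ∷ 2 ∷ 4 ∷ []) ((+ 1) ÷ 16)
  × HasDensity 4 (2 ∷ 4 ∷ 3 ∷ 1 ∷ []) ((+ 1) ÷ 16)
  × HasDensity 4 (1 ∷ 4 ∷ 2 ∷ 3 ∷ []) 0ℚ
  × HasDensity 4 (1 ∷ 4 ∷ 3 ∷ 2 ∷ []) 0ℚ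
  × ((m : ℕ) → Odd m → Distinct (orbit 4 m) → pattern′ (orbit 4 m) ≢ (1 ∷ 4 ∷ 3 ∷ 2 ∷ []))
  × ((m : ℕ) → Odd m → Distinct (orbit 4 m) → pattern′ (orbit 4 m) ≢ (1 ∷ 4 ∷ 2 ∷ 3 ∷ []))
mainTheorem12 =
  (λ m odd-m _ m<S²m S²m<Sm → Sum.map proj₂ (inj₁ ∘ proj₂) (pattern′-of-132 m odd-m m<S²m S²m<Sm)) ,
  -- (+ 2) ÷ 32 normalises to (+ 1) ÷ 16
  HasDensity-of-residue-class 4 _ 32 27 HasPattern-1324⇔residue-27 ,
  HasDensity-of-residue-class 4 _ 32 11 HasPattern-2431⇔residue-11 ,
  HasDensity-of-absent 4 _ (λ m (odd-m , _ , pat) → pattern′≢1423 m odd-m pat) ,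
  HasDensity-of-absent 4 _ (λ m (odd-m , _ , pat) → pattern′≢1432 m odd-m pat) ,
  (λ m odd-m _ → pattern′≢1432 m odd-m) ,
  (λ m odd-m _ → pattern′≢1423 m odd-m)
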